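{- Let $\mathbf E=(E,+,{}',0,1)$ be a monotonous effect algebra with induced order $\leq$, and define, for $x,y\in E$, $x\odot y:=(x'+y')'$, defined if and only if $x'\leq y$, and $x\rightarrow y:=x'+L(x,y)=\{x'+u\mid u\in L(x,y)\}\subseteq E$. Then $(E,\leq,\odot,\rightarrow,{}',0,1)$ is a divisible commutative unsharp residuated poset.
   Context: An effect algebra is a partial algebra $(E,+,{}',0,1)$ of type $(2,1,0,0)$ where $(E,{}',0,1)$ is an algebra and $+$ is a partial binary operation such that for all $x,y,z\in E$: (E1) $x+y$ is defined iff $y+x$ is defined, and then $x+y=y+x$; (E2) $(x+y)+z$ is defined iff $x+(y+z)$ is defined, and then they are equal; (E3) $x'$ is the unique $u\in E$ with $x+u=1$; (E4) if $1+x$ is defined then $x=0$. The induced order is $x\leq y$ iff there is $z\in E$ with $x+z=y$. For a poset $(P,\leq)$ and $A\subseteq P$: $L(A)=\{x\in P\mid x\leq y\ \forall y\in A\}$, $U(A)=\{x\in P\mid y\leq x\ \forall y\in A\}$; we write $L(a,b)=L(\{a,b\})$, $U(a,b)=U(\{a,b\})$, $LU(A)=L(U(A))$, $UL(a,b)=U(L(\{a,b\}))$. For subsets $A,B$, $A\leq B$ means $x\leq y$ for all $x\in A,y\in B$ (and similarly with single elements). Operations are extended elementwise to subsets: $x+A=\{x+y\mid y\in A\}$, $A\odot y=\{u\odot y\mid u\in A\}$, $y\odot A$ similarly, $A'=\{a'\mid a\in A\}$. The effect algebra is monotonous if for all $x\in E$ and all non-empty $A,B\subseteq E$: $A\cup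 B\leq x'$ and $L(A)\leq U(B)$ imply $L(x+A)\leq U(x+B)$. A partial monoid $(A,\odot,1)$ is a set with a partial binary operation such that $(x\odot y)\odot z$ is defined iff $x\odot(y\odot z)$ is defined and then they are equal, and $x\odot1=1\odot x=x$ for all $x$; it is commutative if $x\odot y$ is defined iff $y\odot x$ is defined and then $x\odot y=y\odot x$. A commutative unsharp residuated poset is a tuple $(C,\leq,\odot,\rightarrow,{}',0,1)$ with $\rightarrow:C^2\to 2^C$ such that for all $x,y,z\in C$: (C1) $(C,\leq,{}',0,1)$ is a bounded poset with an antitone involution ${}'$; (C2) $(C,\odot,1)$ is a commutative partial monoid in which $x\odot y$ is defined iff $x'\leq y$, and $z'\leq x\leq y$ implies $x\odot z\leq y\odot z$; (C3) $L(U(x,y')\odot y)\leq UL(y,z)$ if and only if $LU(x,y')\leq U(y\rightarrow z)$; (C4) $x\rightarrow 0=\{x'\}$. It is divisible if $x\leq y$ implies $y\odot(y\rightarrow x)=L(x)$ for all $x,y\in C$. -}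

module Defs where

open import Level using (Level; suc; _⊔_)
open import Data.Product using (Σ; ∃; _×_; _,_)
open import Data.Sum using (_⊎_)
open import Relation.Binary.PropositionalEquality using (_≡_)
open import Relation.Binary.Core using (Rel)
open import Relation.Binary.Structures using (IsPartialOrder)
open import Relation.Unary using (Pred; _≐_; _∪_; Satisfiable)

-- A partial binary operation on C is represented by its graph:
-- G x y z  means  "x ∘ y is defined and equals z".
PartialOp : ∀ {ℓ} → Set ℓ → Set (suc ℓ)
PartialOp {ℓ} C = C → C → C → Set ℓ

record EffectAlgebra (ℓ : Level) : Set (suc ℓ) where
  field
    E    : Set ℓ
    Sum  : PartialOp E
    _′   : E → E
    𝟎 𝟏  : E
    Sum-functional : ∀ {x y z w} → Sum x y z → Sum x y w → z ≡ w
    E1 : ∀ {x y z} → Sum x y z → Sum y x z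
    E2₁ : ∀ {x y z a b} → Sum x y a → Sum a z b → ∃ λ c → Sum y z c × Sum x c b
    E2₂ : ∀ {x y z c b} → Sum y z c → Sum x c b → ∃ λ a → Sum x y a × Sum a z b
    E3-sum    : ∀ x → Sum x (x ′) 𝟏
    E3-unique : ∀ {x u} → Sum x u 𝟏 → u ≡ x ′
    E4 : ∀ {x z} → Sum 𝟏 x z → x ≡ 𝟎

  _≤_ : Rel E ℓ
  x ≤ y = ∃ λ z → Sum x z y

module Cones {ℓ} {C : Set ℓ} (_≤_ : Rel C ℓ) where

  L : Pred C ℓ → Pred C ℓ
  L A x = ∀ y → A y → x ≤ y

  U : Pred C ℓ → Pred C ℓ
  U A x = ∀ y → A y → y ≤ x

  ⦅_,_⦆ : C → C → Pred C ℓ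
  ⦅ a , b ⦆ x = x ≡ a ⊎ x ≡ b

  L₂ : C → C → Pred C ℓ
  L₂ a b = L ⦅ a , b ⦆

  U₂ : C → C → Pred C ℓ
  U₂ a b = U ⦅ a , b ⦆

  _≤ₛ_ : Pred C ℓ → Pred C ℓ → Set ℓ
  A ≤ₛ B = ∀ x y → A x → B y → x ≤ y

  _≤ₑ_ : Pred C ℓ → C → Set ℓ
  A ≤ₑ x = ∀ y → A y → y ≤ x

  _⟨_⟩ᵣ_ : Pred C ℓ → PartialOp C → C → Pred C ℓ
  (A ⟨ G ⟩ᵣ y) w = ∃ λ u → A u × G u y w

  _⟨_⟩ₗ_ : C → PartialOp C → Pred C ℓ → Pred C ℓ
  (x ⟨ G ⟩ₗ A) w = ∃ λ u → A u × G x u w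

Monotonous : ∀ {ℓ} → EffectAlgebra ℓ → Set (suc ℓ)
Monotonous {ℓ} 𝐄 =
  ∀ (x : E) (A B : Pred E ℓ) → Satisfiable A → Satisfiable B →
    (A ∪ B) ≤ₑ (x ′) → L A ≤ₛ U B →
    L (x ⟨ Sum ⟩ₗ A) ≤ₛ U (x ⟨ Sum ⟩ₗ B)
  where open EffectAlgebra 𝐄
        open Cones _≤_

record IsCommUnsharpResiduatedPoset {ℓ} (C : Set ℓ) (_≤_ : Rel C ℓ)
         (M : PartialOp C) (_⇒_ : C → C → Pred C ℓ)
         (_′ : C → C) (𝟎 𝟏 : C) : Set (suc ℓ) where
  open Cones _≤_
  field
    isPartialOrder : IsPartialOrder _≡_ _≤_
    bottom     : ∀ x → 𝟎 ≤ x
    top        : ∀ x → x ≤ 𝟏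
    involutive : ∀ x → (x ′) ′ ≡ x
    antitone   : ∀ {x y} → x ≤ y → (y ′) ≤ (x ′)
    M-functional : ∀ {x y z w} → M x y z → M x y w → z ≡ w
    assoc₁ : ∀ {x y z a b} → M x y a → M a z b → ∃ λ c → M y z c × M x c b
    assoc₂ : ∀ {x y z c b} → M y z c → M x c b → ∃ λ a → M x y a × M a z b
    identityʳ : ∀ x → M x 𝟏 x
    identityˡ : ∀ x → M 𝟏 x x
    comm : ∀ {x y z} → M x y z → M y x z
    defined⇒ : ∀ {x y} → (∃ λ z → M x y z) → (x ′) ≤ y
    ⇒defined : ∀ {x y} → (x ′) ≤ y → ∃ λ z → M x y z
    monotone : ∀ {x y z a b} → (z ′) ≤ x → x ≤ y → M x z a → M y z b → a ≤ b
    C3₁ : ∀ x y z → L (U₂ x (y ′) ⟨ M ⟩ᵣ y) ≤ₛ U (L₂ y z)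
                  → L (U₂ x (y ′)) ≤ₛ U (y ⇒ z)
    C3₂ : ∀ x y z → L (U₂ x (y ′)) ≤ₛ U (y ⇒ z)
                  → L (U₂ x (y ′) ⟨ M ⟩ᵣ y) ≤ₛ U (L₂ y z)
    C4 : ∀ x → (x ⇒ 𝟎) ≐ (λ w → w ≡ x ′)

Divisible : ∀ {ℓ} {C : Set ℓ} (_≤_ : Rel C ℓ) (M : PartialOp C)
            (_⇒_ : C → C → Pred C ℓ) → Set ℓ
Divisible _≤_ M _⇒_ = ∀ {x y} → x ≤ y → (y ⟨ M ⟩ₗ (y ⇒ x)) ≐ L (λ w → w ≡ x)
  where open Cones _≤_

module Derived {ℓ} (𝐄 : EffectAlgebra ℓ) where
  open EffectAlgebra 𝐄
  open Cones _≤_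

  ⊙ : PartialOp E
  ⊙ x y z = ∃ λ s → Sum (x ′) (y ′) s × z ≡ s ′

  _⇒_ : E → E → Pred E ℓ
  x ⇒ y = (x ′) ⟨ Sum ⟩ₗ L₂ x y

-- Everything except (C3) holds in any effect algebra, because u ⊙ y is the
-- difference of u and y′: u ⊙ y = a iff y′ + a = u. Consequently
-- U(x, y′) = y′ + A for A = U(x, y′) ⊙ y, and since y → z = y′ + B for
-- B = L(y, z), condition (C3) says that L(A) ≤ U(B) iff L(y′ + A) ≤ U(y′ + B).
-- Monotonicity is the forward direction. The backward one is monotonicity
-- applied to the relative complements y ⊖ B and y ⊖ A, using that
-- y′ + (y ⊖ S) = S′ and that (y ⊖ S)′ = y′ + S, so that ′ translates the
-- hypothesis and the conclusion into each other.
module Submission where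

open import Defs
open import Data.Product using (_×_; _,_; ∃)
open import Data.Sum using (inj₁; inj₂)
open import Relation.Binary.PropositionalEquality
open import Relation.Binary.Structures using (IsPartialOrder)
open import Relation.Unary using (Pred; _⊆_; _∪_; Satisfiable)

module EffectAlgebraProperties {ℓ} (𝐄 : EffectAlgebra ℓ) where
  open EffectAlgebra 𝐄
  open Cones _≤_
  open Derived 𝐄

  ′-involutive : ∀ x → x ′ ′ ≡ x
  ′-involutive x = sym (E3-unique (E1 (E3-sum x)))

  ′-injective : ∀ {x y} → x ′ ≡ y ′ → x ≡ y
  ′-injective {x} {y} eq = begin
    x      ≡⟨ sym (′-involutive x) ⟩
    x ′ ′  ≡⟨ cong _′ eq ⟩
    y ′ ′  ≡⟨ ′-involutive y ⟩
    y      ∎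
    where open ≡-Reasoning

  𝟏′≡𝟎 : 𝟏 ′ ≡ 𝟎
  𝟏′≡𝟎 = E4 (E3-sum 𝟏)

  Sum-rotate : ∀ {a b c} → Sum a b c → Sum b (c ′) (a ′)
  Sum-rotate {c = c} s with E2₁ s (E3-sum c)
  ... | d , bc′≡d , ad≡𝟏 = subst (Sum _ (c ′)) (E3-unique ad≡𝟏) bc′≡d

  Sum-dual : ∀ {a b c} → Sum a b c → Sum (c ′) b (a ′)
  Sum-dual s = E1 (Sum-rotate s)

  Sum-identityʳ : ∀ x → Sum x 𝟎 x
  Sum-identityʳ x =
    subst₂ (Sum x) 𝟏′≡𝟎 (′-involutive x) (Sum-rotate (E1 (E3-sum x)))

  Sum-identityˡ : ∀ x → Sum 𝟎 x x
  Sum-identityˡ x = E1 (Sum-identityʳ x)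

  Sum-cancelˡ : ∀ {x y z s} → Sum x y s → Sum x z s → y ≡ z
  Sum-cancelˡ p q =
    ′-injective (Sum-functional (Sum-rotate (Sum-rotate p)) (Sum-rotate (Sum-rotate q)))

  Sum-zero : ∀ {a b} → Sum a b 𝟎 → a ≡ 𝟎
  Sum-zero {a} p with E2₁ p (Sum-identityˡ 𝟏)
  ... | _ , b𝟏≡c , _ with E4 (E1 b𝟏≡c)
  ... | refl = Sum-functional (Sum-identityʳ a) p

  ≤-refl : ∀ {x} → x ≤ x
  ≤-refl {x} = 𝟎 , Sum-identityʳ x

  ≤-trans : ∀ {x y z} → x ≤ y → y ≤ z → x ≤ z
  ≤-trans (a , p) (b , q) with E2₁ p q
  ... | c , _ , r = c , r

  ≤-antisym : ∀ {x y} → x ≤ y → y ≤ x → x ≡ y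
  ≤-antisym {x} (a , p) (b , q) with E2₁ p q
  ... | c , ab≡c , xc≡x with Sum-cancelˡ xc≡x (Sum-identityʳ x)
  ... | refl with Sum-zero ab≡c
  ... | refl = Sum-functional (Sum-identityʳ x) p

  ≤-isPartialOrder : IsPartialOrder _≡_ _≤_
  ≤-isPartialOrder = record
    { isPreorder = record
      { isEquivalence = isEquivalence
      ; reflexive     = λ { refl → ≤-refl }
      ; trans         = ≤-trans
      }
    ; antisym = ≤-antisym
    }

  𝟎-≤ : ∀ x → 𝟎 ≤ x
  𝟎-≤ x = x , Sum-identityˡ x

  ≤-𝟏 : ∀ x → x ≤ 𝟏
  ≤-𝟏 x = x ′ , E3-sum x

  ′-antitone : ∀ {x y} → x ≤ y → (y ′) ≤ (x ′)
  ′-antitone (a , p) = a , E1 (Sum-rotate p)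

  ′-reflects-≤ : ∀ {x y} → (x ′) ≤ (y ′) → y ≤ x
  ′-reflects-≤ {x} {y} le =
    subst₂ _≤_ (′-involutive y) (′-involutive x) (′-antitone le)

  ≤-′-swapˡ : ∀ {x y} → (x ′) ≤ y → (y ′) ≤ x
  ≤-′-swapˡ {x} le = subst (_ ≤_) (′-involutive x) (′-antitone le)

  ≤-′-swapʳ : ∀ {x y} → x ≤ (y ′) → y ≤ (x ′)
  ≤-′-swapʳ {y = y} le = subst (_≤ _) (′-involutive y) (′-antitone le)

  Sum⇒≤′ : ∀ {a b c} → Sum a b c → a ≤ (b ′)
  Sum⇒≤′ {c = c} p = c ′ , Sum-rotate (E1 p)

  ≤⇒Sum′ : ∀ {a b} → a ≤ b → ∃ (Sum (b ′) a)
  ≤⇒Sum′ (d , p) = d ′ , E1 (Sum-rotate (E1 p))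

  Sum-monoˡ-≤ : ∀ {a b c s t} → a ≤ b → Sum a c s → Sum b c t → s ≤ t
  Sum-monoˡ-≤ (d , ad≡b) ac≡s bc≡t with E2₁ ad≡b bc≡t
  ... | e , dc≡e , ae≡t with E2₂ (E1 dc≡e) ae≡t
  ... | s′ , ac≡s′ , s′d≡t with Sum-functional ac≡s ac≡s′
  ... | refl = d , s′d≡t

  L-antitone : ∀ {A B : Pred E ℓ} → A ⊆ B → L B ⊆ L A
  L-antitone A⊆B Lw y Ay = Lw y (A⊆B Ay)

  L₂-𝟎 : ∀ {x u} → L₂ x 𝟎 u → u ≡ 𝟎
  L₂-𝟎 Lu = ≤-antisym (Lu 𝟎 (inj₂ refl)) (𝟎-≤ _)

  ⊙⇒Sum : ∀ {u y a} → ⊙ u y a → Sum (y ′) a u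
  ⊙⇒Sum {u} (s , u′y′≡s , refl) =
    subst (Sum _ (s ′)) (′-involutive u) (Sum-rotate u′y′≡s)

  Sum⇒⊙ : ∀ {u y a} → Sum (y ′) a u → ⊙ u y a
  Sum⇒⊙ {a = a} p = a ′ , E1 (Sum-rotate (E1 p)) , sym (′-involutive a)

  ⊙-functional : ∀ {x y z w} → ⊙ x y z → ⊙ x y w → z ≡ w
  ⊙-functional p q = Sum-cancelˡ (⊙⇒Sum p) (⊙⇒Sum q)

  ⊙-comm : ∀ {x y z} → ⊙ x y z → ⊙ y x z
  ⊙-comm (s , p , eq) = s , E1 p , eq

  ⊙-identityʳ : ∀ x → ⊙ x 𝟏 x
  ⊙-identityʳ x = Sum⇒⊙ (subst (λ t → Sum t x x) (sym 𝟏′≡𝟎) (Sum-identityˡ x))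

  ⊙-identityˡ : ∀ x → ⊙ 𝟏 x x
  ⊙-identityˡ x = Sum⇒⊙ (E1 (E3-sum x))

  ⊙-assoc₁ : ∀ {x y z a b} → ⊙ x y a → ⊙ a z b → ∃ λ c → ⊙ y z c × ⊙ x c b
  ⊙-assoc₁ {x} {z = z} (s , x′y′≡s , refl) (t , s′′z′≡t , refl)
    with E2₁ x′y′≡s (subst (λ r → Sum r (z ′) t) (′-involutive s) s′′z′≡t)
  ... | c , y′z′≡c , x′c≡t =
    c ′ , (c , y′z′≡c , refl)
        , (t , subst (λ r → Sum (x ′) r t) (sym (′-involutive c)) x′c≡t , refl)

  ⊙-assoc₂ : ∀ {x y z c b} → ⊙ y z c → ⊙ x c b → ∃ λ a → ⊙ x y a × ⊙ a z b
  ⊙-assoc₂ {x} {z = z} (s , y′z′≡s , refl) (t , x′s′′≡t , refl)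
    with E2₂ y′z′≡s (subst (λ r → Sum (x ′) r t) (′-involutive s) x′s′′≡t)
  ... | a , x′y′≡a , az′≡t =
    a ′ , (a , x′y′≡a , refl)
        , (t , subst (λ r → Sum r (z ′) t) (sym (′-involutive a)) az′≡t , refl)

  ⊙-defined⇒ : ∀ {x y} → (∃ λ z → ⊙ x y z) → (x ′) ≤ y
  ⊙-defined⇒ (z , m) = z , ⊙⇒Sum (⊙-comm m)

  ⇒⊙-defined : ∀ {x y} → (x ′) ≤ y → ∃ λ z → ⊙ x y z
  ⇒⊙-defined (z , p) = z , ⊙-comm (Sum⇒⊙ p)

  ⊙-monoˡ-≤ : ∀ {x y z a b} → x ≤ y → ⊙ x z a → ⊙ y z b → a ≤ b
  ⊙-monoˡ-≤ x≤y (s , p , refl) (t , q , refl) =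
    ′-antitone (Sum-monoˡ-≤ (′-antitone x≤y) q p)

  ⊙-≤ʳ : ∀ {u y a} → ⊙ u y a → a ≤ (y ′ ′)
  ⊙-≤ʳ m = Sum⇒≤′ (E1 (⊙⇒Sum m))

  ⇒-𝟎 : ∀ x → (x ⇒ 𝟎) ⊆ (λ w → w ≡ x ′)
  ⇒-𝟎 x (u , Lu , p) with L₂-𝟎 Lu
  ... | refl = Sum-functional p (Sum-identityʳ (x ′))

  𝟎-⇒ : ∀ x → (λ w → w ≡ x ′) ⊆ (x ⇒ 𝟎)
  𝟎-⇒ x refl = 𝟎 , (λ _ _ → 𝟎-≤ _) , Sum-identityʳ (x ′)

  Sum′⇒⊙ : ∀ {y u e} → Sum (y ′) u e → ⊙ y e u
  Sum′⇒⊙ {y} {u} {e} p = Sum⇒⊙ (subst (Sum (e ′) u) (′-involutive y) (Sum-dual p))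

  divisible : Divisible _≤_ ⊙ _⇒_
  divisible {x} {y} x≤y = ⊙⇒⊆L , L⊆⊙⇒
    where
    ⊙⇒⊆L : (y ⟨ ⊙ ⟩ₗ (y ⇒ x)) ⊆ L (λ k → k ≡ x)
    ⊙⇒⊆L (e , (u , Lu , y′u≡e) , m) _ refl =
      subst (_≤ x) (⊙-functional (Sum′⇒⊙ y′u≡e) m) (Lu x (inj₂ refl))
    L⊆⊙⇒ : L (λ k → k ≡ x) ⊆ (y ⟨ ⊙ ⟩ₗ (y ⇒ x))
    L⊆⊙⇒ {w} Lw =
      let w≤x = Lw x refl
          w≤y = ≤-trans w≤x x≤y
          (e , y′w≡e) = ≤⇒Sum′ w≤y
      in e , (w , (λ { _ (inj₁ refl) → w≤y ; _ (inj₂ refl) → w≤x }) , y′w≡e)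
           , Sum′⇒⊙ y′w≡e

  infix 10 _⊖_
  _⊖_ : E → Pred E ℓ → Pred E ℓ
  (c ⊖ S) w = ∃ λ b → S b × Sum w b c

  Sum-⊖ : ∀ {x w e b} → Sum x w e → Sum w b (x ′) → e ≡ b ′
  Sum-⊖ {e = e} xw≡e wb≡x′ =
    trans (sym (′-involutive e)) (cong _′ (Sum-cancelˡ (E1 (Sum-dual xw≡e)) wb≡x′))

  monotonous-cancel : Monotonous 𝐄 → ∀ x (A B : Pred E ℓ) →
    Satisfiable A → Satisfiable B → (A ∪ B) ≤ₑ (x ′) →
    L (x ⟨ Sum ⟩ₗ A) ≤ₛ U (x ⟨ Sum ⟩ₗ B) → L A ≤ₛ U B
  monotonous-cancel mon x A B (a , Aa) (b , Bb) bounded H p q Lp Uq =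
    ′-reflects-≤
      (mon x (x ′ ⊖ B) (x ′ ⊖ A) (⊖-nonempty Bb (bounded b (inj₂ Bb)))
        (⊖-nonempty Aa (bounded a (inj₁ Aa))) ⊖-bounded ⊖-separated
        (q ′) (p ′) q′∈L p′∈U)
    where
    ⊖-nonempty : ∀ {S b} → S b → b ≤ (x ′) → Satisfiable (x ′ ⊖ S)
    ⊖-nonempty {b = b} Sb (w , bw≡x′) = w , b , Sb , E1 bw≡x′
    ⊖-bounded : ((x ′ ⊖ B) ∪ (x ′ ⊖ A)) ≤ₑ (x ′)
    ⊖-bounded _ (inj₁ (b , _ , wb≡x′)) = b , wb≡x′
    ⊖-bounded _ (inj₂ (a , _ , wa≡x′)) = a , wa≡x′
    ⊖-separated : L (x ′ ⊖ B) ≤ₛ U (x ′ ⊖ A)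
    ⊖-separated r t Lr Ut = ′-reflects-≤ (H (t ′) (r ′) t′∈L r′∈U)
      where
      t′∈L : L (x ⟨ Sum ⟩ₗ A) (t ′)
      t′∈L e (a , Aa , xa≡e) = ≤-′-swapˡ (Ut (e ′) (a , Aa , Sum-dual xa≡e))
      r′∈U : U (x ⟨ Sum ⟩ₗ B) (r ′)
      r′∈U e (b , Bb , xb≡e) = ≤-′-swapʳ (Lr (e ′) (b , Bb , Sum-dual xb≡e))
    q′∈L : L (x ⟨ Sum ⟩ₗ (x ′ ⊖ B)) (q ′)
    q′∈L e (w , (b , Bb , wb≡x′) , xw≡e) =
      subst ((q ′) ≤_) (sym (Sum-⊖ xw≡e wb≡x′)) (′-antitone (Uq b Bb))
    p′∈U : U (x ⟨ Sum ⟩ₗ (x ′ ⊖ A)) (p ′)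
    p′∈U e (w , (a , Aa , wa≡x′) , xw≡e) =
      subst (_≤ (p ′)) (sym (Sum-⊖ xw≡e wa≡x′)) (′-antitone (Lp a Aa))

  Sum-⊙ʳ-⊆ : ∀ {S : Pred E ℓ} y → ((y ′) ⟨ Sum ⟩ₗ (S ⟨ ⊙ ⟩ᵣ y)) ⊆ S
  Sum-⊙ʳ-⊆ {S} y (a , (u , Su , m) , y′a≡e) =
    subst S (Sum-functional (⊙⇒Sum m) y′a≡e) Su

  ⊆-Sum-⊙ʳ : ∀ {S : Pred E ℓ} y → (∀ {u} → S u → (y ′) ≤ u) →
    S ⊆ ((y ′) ⟨ Sum ⟩ₗ (S ⟨ ⊙ ⟩ᵣ y))
  ⊆-Sum-⊙ʳ y y′≤ Su with y′≤ Su
  ... | d , y′d≡u = d , (_ , Su , Sum⇒⊙ y′d≡u) , y′d≡u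

  module Residuation (mon : Monotonous 𝐄) (x y z : E) where

    A B : Pred E ℓ
    A = U₂ x (y ′) ⟨ ⊙ ⟩ᵣ y
    B = L₂ y z

    A-nonempty : Satisfiable A
    A-nonempty = y , 𝟏 , (λ _ _ → ≤-𝟏 _) , ⊙-identityˡ y

    B-nonempty : Satisfiable B
    B-nonempty = 𝟎 , λ _ _ → 𝟎-≤ _

    bounded : (A ∪ B) ≤ₑ (y ′ ′)
    bounded _ (inj₁ (_ , _ , m)) = ⊙-≤ʳ m
    bounded k (inj₂ Lk) = subst (k ≤_) (sym (′-involutive y)) (Lk y (inj₁ refl))

    residuation₁ : L A ≤ₛ U B → L (U₂ x (y ′)) ≤ₛ U (y ⇒ z)
    residuation₁ G w v Lw =
      mon (y ′) A B A-nonempty B-nonempty bounded G w v (L-antitone (Sum-⊙ʳ-⊆ y) Lw)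

    residuation₂ : L (U₂ x (y ′)) ≤ₛ U (y ⇒ z) → L A ≤ₛ U B
    residuation₂ H = monotonous-cancel mon (y ′) A B A-nonempty B-nonempty bounded
      λ w v Lw → H w v (L-antitone (⊆-Sum-⊙ʳ y (λ Uu → Uu (y ′) (inj₂ refl))) Lw)

  isCommUnsharpResiduatedPoset :
    Monotonous 𝐄 → IsCommUnsharpResiduatedPoset E _≤_ ⊙ _⇒_ _′ 𝟎 𝟏
  isCommUnsharpResiduatedPoset mon = record
    { isPartialOrder = ≤-isPartialOrder
    ; bottom         = 𝟎-≤
    ; top            = ≤-𝟏
    ; involutive     = ′-involutive
    ; antitone       = ′-antitone
    ; M-functional   = ⊙-functional
    ; assoc₁         = ⊙-assoc₁
    ; assoc₂         = ⊙-assoc₂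
    ; identityʳ      = ⊙-identityʳ
    ; identityˡ      = ⊙-identityˡ
    ; comm           = ⊙-comm
    ; defined⇒       = ⊙-defined⇒
    ; ⇒defined       = ⇒⊙-defined
    ; monotone       = λ _ → ⊙-monoˡ-≤
    ; C3₁            = λ x y z → Residuation.residuation₁ mon x y z
    ; C3₂            = λ x y z → Residuation.residuation₂ mon x y z
    ; C4             = λ x → ⇒-𝟎 x , 𝟎-⇒ x
    }

theorem1 : ∀ {ℓ} (𝐄 : EffectAlgebra ℓ) → Monotonous 𝐄 →
    IsCommUnsharpResiduatedPoset (EffectAlgebra.E 𝐄) (EffectAlgebra._≤_ 𝐄)
      (Derived.⊙ 𝐄) (Derived._⇒_ 𝐄) (EffectAlgebra._′ 𝐄)
      (EffectAlgebra.𝟎 𝐄) (EffectAlgebra.𝟏 𝐄)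
    × Divisible (EffectAlgebra._≤_ 𝐄) (Derived.⊙ 𝐄) (Derived._⇒_ 𝐄)
theorem1 𝐄 mon = isCommUnsharpResiduatedPoset mon , divisible
  where open EffectAlgebraProperties 𝐄
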